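{- Let $\mathcal V=(1,Q,\Delta)$ be a 1-dimensional VASS, $s,t\in Q$ and $m,n\in\mathbb N$. Then $t(n)$ is reachable from $s(m)$ in $\mathcal V$ under monus semantics if and only if (i) $t(n)$ is reachable from $s(m)$ in $\mathcal V$ under classical semantics, or (ii) there exist a state $q\in Q$ and a number $m'\ge m$ such that $q(0)$ is reachable from $s(m')$ under classical semantics and $t(n)$ is reachable from $q(0)$ under classical semantics.
   Context: A 1-dimensional VASS is $\mathcal V=(1,Q,\Delta)$ with $Q$ a finite set of states and $\Delta\subseteq Q\times\mathbb Z\times Q$ finite; configurations are $p(u)$ with $p\in Q$, $u\in\mathbb N$. Classical semantics: a transition $(p,z,q)$ takes $p(u)$ to $q(u+z)$, allowed only if $u+z\ge0$. Monus semantics: $(p,z,q)$ takes $p(u)$ to $q(\max(u+z,0))$, always allowed. Reachability means existence of a finite (possibly empty) sequence of steps. -}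

module Defs where

open import Data.Nat using (ℕ)
open import Data.Fin using (Fin)
open import Data.Integer using (ℤ; +_; _+_; _⊖_)
import Data.Integer as ℤ
open import Data.Product using (_×_; _,_)
open import Data.List using (List)
open import Data.List.Membership.Propositional using (_∈_)
open import Relation.Binary.PropositionalEquality using (_≡_)
open import Relation.Binary.Construct.Closure.ReflexiveTransitive using (Star)

record VASS1 : Set where
  field
    k : ℕ
    Δ : List (Fin k × ℤ × Fin k)
open VASS1 public

State : VASS1 → Set
State V = Fin (k V)

Config : VASS1 → Set
Config V = State V × ℕ

-- Classical semantics: (p,z,q) takes p(u) to q(u+z), only if u+z ≥ 0.
data StepC (V : VASS1) : Config V → Config V → Set where
  stepC : ∀ {p z q u v} → (p , z , q) ∈ Δ V → (+ u) + z ≡ + v →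
          StepC V (p , u) (q , v)

data StepM (V : VASS1) : Config V → Config V → Set where
  stepM : ∀ {p z q u} → (p , z , q) ∈ Δ V →
          StepM V (p , u) (q , ℤ.∣ (+ u) + z ℤ.⊔ + 0 ∣)

ReachC : (V : VASS1) → Config V → Config V → Set
ReachC V = Star (StepC V)

ReachM : (V : VASS1) → Config V → Config V → Set
ReachM V = Star (StepM V)

{-# OPTIONS --safe #-}
-- A monus run either never clips the counter at 0, in which case it is a
-- classical run, or it does; its last clipping step ends at some q(0), and
-- from there on it is a classical run. The prefix up to that step is lifted
-- backwards to a classical run from s(m′) with m′ ≥ m: each step can start
-- high enough to land exactly on the counter value needed afterwards.
-- Conversely, a classical run is a monus run, and a monus run started below
-- a classical one stays below it, so it reaches q(0) as well.
module Submission where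

open import Defs
open import Data.Nat using (ℕ; _≥_)
open import Data.Nat using (zero)
open import Data.Product using (_×_; _,_; ∃; ∃-syntax; Σ-syntax)
open import Data.Sum using (_⊎_)
open import Function.Bundles using (_⇔_)

open import Data.Sum using (inj₁; inj₂; [_,_])
import Data.Nat as ℕ
import Data.Nat.Properties as ℕ
open import Data.Integer using (ℤ; +_; -[1+_]; _+_; -_; _-_; _⊔_; ∣_∣; _≤_; +≤+; -≤+)
import Data.Integer.Properties as ℤ
open import Algebra.Properties.AbelianGroup ℤ.+-0-abelianGroup using (//-rightDividesˡ; //-rightDividesʳ)
open import Data.List.Membership.Propositional using (_∈_)
open import Relation.Binary.PropositionalEquality using (_≡_; refl; sym; trans; cong; subst)
open import Relation.Binary.Construct.Closure.ReflexiveTransitive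
  using (ε; _◅_; _◅◅_; map)
open import Function.Bundles using (mk⇔)

-- A monus step (p , z , q) takes p(u) to q(clamp (+ u + z)), definitionally.
clamp : ℤ → ℕ
clamp x = ∣ x ⊔ + 0 ∣

clamp-+ : ∀ n → clamp (+ n) ≡ n
clamp-+ = ℕ.⊔-identityʳ

≤-clamp : ∀ x → x ≤ + clamp x
≤-clamp (+ n)    = +≤+ (ℕ.m≤m⊔n n 0)
≤-clamp -[1+ n ] = -≤+

clamp-least : ∀ {x n} → x ≤ + n → clamp x ℕ.≤ n
clamp-least {+ m}       (+≤+ m≤n) = subst (ℕ._≤ _) (sym (clamp-+ m)) m≤n
clamp-least { -[1+ m ]} _      = ℕ.z≤n

clamp-exact-or-zero : ∀ x → + clamp x ≡ x ⊎ clamp x ≡ 0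
clamp-exact-or-zero (+ n)    = inj₁ (cong +_ (clamp-+ n))
clamp-exact-or-zero -[1+ n ] = inj₂ refl

module _ {V : VASS1} where

  ReachC-via-zero : Config V → Config V → Set
  ReachC-via-zero (s , m) d =
    Σ[ q ∈ State V ] Σ[ m′ ∈ ℕ ]
      (m′ ≥ m × ReachC V (s , m′) (q , zero) × ReachC V (q , zero) d)

  StepC⇒StepM : ∀ {c d} → StepC V c d → StepM V c d
  StepC⇒StepM (stepC {p = p} {q = q} {u = u} {v = v} t∈Δ u+z≡v) =
    subst (λ w → StepM V (p , u) (q , w))
          (trans (cong clamp u+z≡v) (clamp-+ v))
          (stepM t∈Δ)

  ReachC⇒ReachM : ∀ {c d} → ReachC V c d → ReachM V c d
  ReachC⇒ReachM = map StepC⇒StepM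

  ReachC⇒ReachM-below : ∀ {p q a b c} → ReachC V (p , a) (q , b) → c ℕ.≤ a →
                        ∃[ d ] (d ℕ.≤ b × ReachM V (p , c) (q , d))
  ReachC⇒ReachM-below ε c≤a = _ , c≤a , ε
  ReachC⇒ReachM-below {c = c} (stepC {z = z} t∈Δ a+z≡v ◅ run) c≤a
    with ReachC⇒ReachM-below run (clamp-least c+z≤v)
    where
    c+z≤v : + c + z ≤ _
    c+z≤v = subst (_ ≤_) a+z≡v (ℤ.+-monoˡ-≤ z (+≤+ c≤a))
  ... | d , d≤b , run′ = d , d≤b , stepM t∈Δ ◅ run′

  StepC-from-above : ∀ {p z q u v} → (p , z , q) ∈ Δ V →
                     + u + z ≤ + v →
                     ∃[ u′ ] (u′ ≥ u × StepC V (p , u′) (q , v))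
  StepC-from-above {z = z} {u = u} {v = v} t∈Δ u+z≤v =
    ∣ + v - z ∣ , ℤ.drop‿+≤+ u≤u′ , stepC t∈Δ u′+z≡v
    where
    u≤v-z : + u ≤ + v - z
    u≤v-z = subst (_≤ + v - z) (//-rightDividesʳ z (+ u)) (ℤ.+-monoˡ-≤ (- z) u+z≤v)
    u′≡v-z : + ∣ + v - z ∣ ≡ + v - z
    u′≡v-z = ℤ.0≤i⇒+∣i∣≡i (ℤ.≤-trans (+≤+ ℕ.z≤n) u≤v-z)
    u≤u′ : + u ≤ + ∣ + v - z ∣
    u≤u′ = subst (+ u ≤_) (sym u′≡v-z) u≤v-z
    u′+z≡v : + ∣ + v - z ∣ + z ≡ + v
    u′+z≡v = trans (cong (_+ z) u′≡v-z) (//-rightDividesˡ z (+ v))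

  StepM-◅-via-zero : ∀ {c c′ d} → StepM V c c′ → ReachC-via-zero c′ d → ReachC-via-zero c d
  StepM-◅-via-zero (stepM t∈Δ) (q , m′ , m′≥clamp , run₁ , run₂)
    with StepC-from-above t∈Δ (ℤ.≤-trans (≤-clamp _) (+≤+ m′≥clamp))
  ... | u′ , u′≥u , step = q , u′ , u′≥u , step ◅ run₁ , run₂

  StepM-◅-ReachC : ∀ {c c′ d} → StepM V c c′ → ReachC V c′ d →
                   ReachC V c d ⊎ ReachC-via-zero c d
  StepM-◅-ReachC {c = _ , u} (stepM {z = z} {q = q} t∈Δ) run
    with clamp-exact-or-zero (+ u + z)
  ... | inj₁ unclipped = inj₁ (stepC t∈Δ (sym unclipped) ◅ run)
  ... | inj₂ clipped
    with StepC-from-above t∈Δ (subst (λ w → + u + z ≤ + w) clipped (≤-clamp (+ u + z)))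
  ... | u′ , u′≥u , step =
    inj₂ (q , u′ , u′≥u , step ◅ ε , subst (λ w → ReachC V (q , w) _) clipped run)

  ReachM⇒ReachC⊎via-zero : ∀ {c d} → ReachM V c d → ReachC V c d ⊎ ReachC-via-zero c d
  ReachM⇒ReachC⊎via-zero ε = inj₁ ε
  ReachM⇒ReachC⊎via-zero (step ◅ run) =
    [ StepM-◅-ReachC step , (λ via → inj₂ (StepM-◅-via-zero step via)) ]
      (ReachM⇒ReachC⊎via-zero run)

  via-zero⇒ReachM : ∀ {c d} → ReachC-via-zero c d → ReachM V c d
  via-zero⇒ReachM {c = s , m} (q , m′ , m′≥m , run₁ , run₂)
    with ReachC⇒ReachM-below run₁ m′≥m
  ... | d , d≤0 , run₁′ =
    subst (λ w → ReachM V (s , m) (q , w)) (ℕ.n≤0⇒n≡0 d≤0) run₁′ ◅◅ ReachC⇒ReachM run₂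

lemma18 : (V : VASS1) (s t : State V) (m n : ℕ) →
    ReachM V (s , m) (t , n) ⇔
      (ReachC V (s , m) (t , n) ⊎
       (Σ[ q ∈ State V ] Σ[ m′ ∈ ℕ ]
          (m′ ≥ m × ReachC V (s , m′) (q , zero) × ReachC V (q , zero) (t , n))))
lemma18 V s t m n =
  mk⇔ ReachM⇒ReachC⊎via-zero [ ReachC⇒ReachM , via-zero⇒ReachM ]
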